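{- The rule $(\forall\text{ - }\mathrm{R_{ms}})$ is not a derived rule of $\forall\mathbf{HLJ}$, nor of $\forall\mathbf{HLJ}'$.
   Context: Formulas are first-order formulas built from atoms and $\bot$ with $\land,\lor,\to,\forall,\exists$. A sequent $\Gamma\Rightarrow\Delta$ consists of finite sequences of formulas; a hypersequent is a finite sequence of sequents $\Gamma_1\Rightarrow\Delta_1\mid\cdots\mid\Gamma_n\Rightarrow\Delta_n$; $G,H$ denote possibly empty hypersequents, $S,T$ sequents. $\mathbf{HLK}$ has: axioms $\varphi\Rightarrow\varphi$, $\bot\Rightarrow\varphi$; external weakening (from $G$ infer $S\mid G$), contraction (from $S\mid S\mid G$ infer $S\mid G$), exchange (from $G\mid S\mid T\mid H$ infer $G\mid T\mid S\mid H$); internal weakening, contraction and exchange on either side of a component, with arbitrary side hypersequent $G$; cut: from $\Gamma_0\Rightarrow\Delta_0,\delta\mid G$ and $\delta,\Gamma_1\Rightarrow\Delta_1\mid G$ infer $\Gamma_0,\Gamma_1\Rightarrow\Delta_0,\Delta_1\mid G$; logical rules with side hypersequent $G$: from $\varphi_i,\Gamma\Rightarrow\Delta\mid G$ infer $\varphi_1\land\varphi_2,\Gamma\Rightarrow\Delta\mid G$; from $\Gamma\Rightarrow\Delta,\varphi_1\mid G$ and $\Gamma\Rightarrow\Delta,\varphi_2\mid G$ infer $\Gamma\Rightarrow\Delta,\varphi_1\land\varphi_2\mid G$; from $\varphi_1,\Gamma\Rightarrow\Delta\mid G$ and $\varphi_2,\Gamma\Rightarrow\Delta\mid G$ infer $\varphi_1\lor\varphi_2,\Gamma\Rightarrow\Delta\mid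 G$; from $\Gamma\Rightarrow\Delta,\varphi_i\mid G$ infer $\Gamma\Rightarrow\Delta,\varphi_1\lor\varphi_2\mid G$; from $\Gamma\Rightarrow\Delta,\varphi\mid G$ and $\psi,\Gamma\Rightarrow\Delta\mid G$ infer $\varphi\to\psi,\Gamma\Rightarrow\Delta\mid G$; from $\varphi,\Gamma\Rightarrow\Delta,\psi\mid G$ infer $\Gamma\Rightarrow\Delta,\varphi\to\psi\mid G$. $\mathbf{HLJ}'$ is $\mathbf{HLK}$ with the last rule replaced by: from $\varphi,\Gamma\Rightarrow\psi\mid G$ infer $\Gamma\Rightarrow\varphi\to\psi\mid G$. $\mathbf{HLJ}$ is $\mathbf{HLK}$ restricted to single-conclusion sequents (every succedent has at most one formula). $\forall\mathbf{HLJ}$ (resp. $\forall\mathbf{HLJ}'$) is $\mathbf{HLJ}$ (resp. $\mathbf{HLJ}'$) plus: from $[t/x]\varphi,\Gamma\Rightarrow\Delta\mid G$ infer $\forall x\varphi,\Gamma\Rightarrow\Delta\mid G$; from $\Gamma\Rightarrow\varphi$ infer $\Gamma\Rightarrow\forall x\varphi$ (single component, $x$ not free in $\Gamma$); from $\varphi,\Gamma\Rightarrow\Delta$ infer $\exists x\varphi,\Gamma\Rightarrow\Delta$ (single component, $x$ not free in $\Gamma,\Delta$); from $\Gamma\Rightarrow\Delta,[t/x]\psi\mid G$ infer $\Gamma\Rightarrow\Delta,\exists x\psi\mid G$. $(\forall\text{ - }\mathrm{R_{ms}})$ (multi-component single-conclusioned $\forall$-right): from $\Gamma\Rightarrow\varphi\mid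 G$ infer $\Gamma\Rightarrow\forall x\varphi\mid G$, provided $x$ does not occur free in the conclusion $\Gamma\Rightarrow\forall x\varphi\mid G$. -}

module Defs where

open import Data.Nat using (ℕ; _≤_; _≟_)
open import Data.List using (List; []; _∷_; _++_; [_]; length)
open import Data.List.Relation.Unary.All using (All)
open import Data.List.Relation.Unary.Any using (Any)
open import Data.Product using (_×_)
open import Data.Unit using (⊤)
open import Relation.Nullary using (¬_; yes; no)
open import Relation.Binary.PropositionalEquality using (_≡_; _≢_)

data Term : Set where
  var : ℕ → Term
  fn  : ℕ → List Term → Term

data Formula : Set where
  atom : ℕ → List Term → Formula
  ⊥′   : Formula
  _∧′_ : Formula → Formula → Formula
  _∨′_ : Formula → Formula → Formula
  _⇒′_ : Formula → Formula → Formula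
  ∀′   : ℕ → Formula → Formula
  ∃′   : ℕ → Formula → Formula

infixr 9 _∧′_
infixr 8 _∨′_
infixr 7 _⇒′_

data OccursT (x : ℕ) : Term → Set where
  oc-var : OccursT x (var x)
  oc-fn  : ∀ {f ts} → Any (OccursT x) ts → OccursT x (fn f ts)

data FreeIn (x : ℕ) : Formula → Set where
  fi-atom : ∀ {p ts} → Any (OccursT x) ts → FreeIn x (atom p ts)
  fi-∧l : ∀ {φ ψ} → FreeIn x φ → FreeIn x (φ ∧′ ψ)
  fi-∧r : ∀ {φ ψ} → FreeIn x ψ → FreeIn x (φ ∧′ ψ)
  fi-∨l : ∀ {φ ψ} → FreeIn x φ → FreeIn x (φ ∨′ ψ)
  fi-∨r : ∀ {φ ψ} → FreeIn x ψ → FreeIn x (φ ∨′ ψ)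
  fi-⇒l : ∀ {φ ψ} → FreeIn x φ → FreeIn x (φ ⇒′ ψ)
  fi-⇒r : ∀ {φ ψ} → FreeIn x ψ → FreeIn x (φ ⇒′ ψ)
  fi-∀  : ∀ {y φ} → x ≢ y → FreeIn x φ → FreeIn x (∀′ y φ)
  fi-∃  : ∀ {y φ} → x ≢ y → FreeIn x φ → FreeIn x (∃′ y φ)

FreeInL : ℕ → List Formula → Set
FreeInL x Γ = Any (FreeIn x) Γ

mutual
  substT : ℕ → Term → Term → Term
  substT x t (var y) with x ≟ y
  ... | yes _ = t
  ... | no  _ = var y
  substT x t (fn f ts) = fn f (substTs x t ts)

  substTs : ℕ → Term → List Term → List Term
  substTs x t [] = []
  substTs x t (u ∷ us) = substT x t u ∷ substTs x t us

substF : ℕ → Term → Formula → Formula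
substF x t (atom p ts) = atom p (substTs x t ts)
substF x t ⊥′ = ⊥′
substF x t (φ ∧′ ψ) = substF x t φ ∧′ substF x t ψ
substF x t (φ ∨′ ψ) = substF x t φ ∨′ substF x t ψ
substF x t (φ ⇒′ ψ) = substF x t φ ⇒′ substF x t ψ
substF x t (∀′ y φ) with x ≟ y
... | yes _ = ∀′ y φ
... | no  _ = ∀′ y (substF x t φ)
substF x t (∃′ y φ) with x ≟ y
... | yes _ = ∃′ y φ
... | no  _ = ∃′ y (substF x t φ)

-- t is free for x in φ (no variable of t gets captured), the usual
-- side condition under which [t/x]φ = substF x t φ is a substitution.
data FreeFor (t : Term) (x : ℕ) : Formula → Set where
  ff-atom : ∀ {p ts} → FreeFor t x (atom p ts)
  ff-⊥    : FreeFor t x ⊥′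
  ff-∧ : ∀ {φ ψ} → FreeFor t x φ → FreeFor t x ψ → FreeFor t x (φ ∧′ ψ)
  ff-∨ : ∀ {φ ψ} → FreeFor t x φ → FreeFor t x ψ → FreeFor t x (φ ∨′ ψ)
  ff-⇒ : ∀ {φ ψ} → FreeFor t x φ → FreeFor t x ψ → FreeFor t x (φ ⇒′ ψ)
  ff-∀-nf : ∀ {y φ} → ¬ FreeIn x (∀′ y φ) → FreeFor t x (∀′ y φ)
  ff-∀    : ∀ {y φ} → ¬ OccursT y t → FreeFor t x φ → FreeFor t x (∀′ y φ)
  ff-∃-nf : ∀ {y φ} → ¬ FreeIn x (∃′ y φ) → FreeFor t x (∃′ y φ)
  ff-∃    : ∀ {y φ} → ¬ OccursT y t → FreeFor t x φ → FreeFor t x (∃′ y φ)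

record Sequent : Set where
  constructor _⊢_
  field
    ante : List Formula
    succ : List Formula
open Sequent public

infix 3 _⊢_

Hypersequent : Set
Hypersequent = List Sequent

FreeInS : ℕ → Sequent → Set
FreeInS x (Γ ⊢ Δ) = Any (FreeIn x) (Γ ++ Δ)

FreeInH : ℕ → Hypersequent → Set
FreeInH x H = Any (FreeInS x) H

SingleConclusion : Hypersequent → Set
SingleConclusion H = All (λ S → length (succ S) ≤ 1) H

data System : Set where
  ∀HLJ ∀HLJ′ : System

OK : System → Hypersequent → Set
OK ∀HLJ  H = SingleConclusion H
OK ∀HLJ′ H = ⊤

-- Derivations in system s from the (single) extra premise P, used as a
-- leaf.  Each node requires its conclusion to be admissible in the
-- system (single-conclusion for ∀HLJ), so every hypersequent occurring
-- in an ∀HLJ derivation is single-conclusioned.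
-- The active component is written in front:  S ∷ G  is  S | G.
data Deriv (s : System) (P : Hypersequent) : Hypersequent → Set where
  hyp : OK s P → Deriv s P P
  ax   : ∀ {φ} → OK s ((φ ∷ [] ⊢ φ ∷ []) ∷ []) →
         Deriv s P ((φ ∷ [] ⊢ φ ∷ []) ∷ [])
  ax⊥  : ∀ {φ} → OK s ((⊥′ ∷ [] ⊢ φ ∷ []) ∷ []) →
         Deriv s P ((⊥′ ∷ [] ⊢ φ ∷ []) ∷ [])
  ew : ∀ {S G} → OK s (S ∷ G) → Deriv s P G → Deriv s P (S ∷ G)
  ec : ∀ {S G} → OK s (S ∷ G) → Deriv s P (S ∷ S ∷ G) → Deriv s P (S ∷ G)
  ee : ∀ {G S T H} → OK s (G ++ T ∷ S ∷ H) →
       Deriv s P (G ++ S ∷ T ∷ H) → Deriv s P (G ++ T ∷ S ∷ H)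
  iwL : ∀ {φ Γ Δ G} → OK s ((φ ∷ Γ ⊢ Δ) ∷ G) →
        Deriv s P ((Γ ⊢ Δ) ∷ G) → Deriv s P ((φ ∷ Γ ⊢ Δ) ∷ G)
  iwR : ∀ {φ Γ Δ G} → OK s ((Γ ⊢ Δ ++ [ φ ]) ∷ G) →
        Deriv s P ((Γ ⊢ Δ) ∷ G) → Deriv s P ((Γ ⊢ Δ ++ [ φ ]) ∷ G)
  icL : ∀ {φ Γ Δ G} → OK s ((φ ∷ Γ ⊢ Δ) ∷ G) →
        Deriv s P ((φ ∷ φ ∷ Γ ⊢ Δ) ∷ G) → Deriv s P ((φ ∷ Γ ⊢ Δ) ∷ G)
  icR : ∀ {φ Γ Δ G} → OK s ((Γ ⊢ Δ ++ [ φ ]) ∷ G) →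
        Deriv s P ((Γ ⊢ Δ ++ φ ∷ φ ∷ []) ∷ G) →
        Deriv s P ((Γ ⊢ Δ ++ [ φ ]) ∷ G)
  ieL : ∀ {φ ψ Γ Π Δ G} → OK s ((Γ ++ ψ ∷ φ ∷ Π ⊢ Δ) ∷ G) →
        Deriv s P ((Γ ++ φ ∷ ψ ∷ Π ⊢ Δ) ∷ G) →
        Deriv s P ((Γ ++ ψ ∷ φ ∷ Π ⊢ Δ) ∷ G)
  ieR : ∀ {φ ψ Γ Δ Σ G} → OK s ((Γ ⊢ Δ ++ ψ ∷ φ ∷ Σ) ∷ G) →
        Deriv s P ((Γ ⊢ Δ ++ φ ∷ ψ ∷ Σ) ∷ G) →
        Deriv s P ((Γ ⊢ Δ ++ ψ ∷ φ ∷ Σ) ∷ G)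
  cut : ∀ {Γ₀ Δ₀ Γ₁ Δ₁ δ G} → OK s ((Γ₀ ++ Γ₁ ⊢ Δ₀ ++ Δ₁) ∷ G) →
        Deriv s P ((Γ₀ ⊢ Δ₀ ++ [ δ ]) ∷ G) →
        Deriv s P ((δ ∷ Γ₁ ⊢ Δ₁) ∷ G) →
        Deriv s P ((Γ₀ ++ Γ₁ ⊢ Δ₀ ++ Δ₁) ∷ G)
  ∧L₁ : ∀ {φ₁ φ₂ Γ Δ G} → OK s ((φ₁ ∧′ φ₂ ∷ Γ ⊢ Δ) ∷ G) →
        Deriv s P ((φ₁ ∷ Γ ⊢ Δ) ∷ G) → Deriv s P ((φ₁ ∧′ φ₂ ∷ Γ ⊢ Δ) ∷ G)
  ∧L₂ : ∀ {φ₁ φ₂ Γ Δ G} → OK s ((φ₁ ∧′ φ₂ ∷ Γ ⊢ Δ) ∷ G) →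
        Deriv s P ((φ₂ ∷ Γ ⊢ Δ) ∷ G) → Deriv s P ((φ₁ ∧′ φ₂ ∷ Γ ⊢ Δ) ∷ G)
  ∧R  : ∀ {φ₁ φ₂ Γ Δ G} → OK s ((Γ ⊢ Δ ++ [ φ₁ ∧′ φ₂ ]) ∷ G) →
        Deriv s P ((Γ ⊢ Δ ++ [ φ₁ ]) ∷ G) →
        Deriv s P ((Γ ⊢ Δ ++ [ φ₂ ]) ∷ G) →
        Deriv s P ((Γ ⊢ Δ ++ [ φ₁ ∧′ φ₂ ]) ∷ G)
  ∨L  : ∀ {φ₁ φ₂ Γ Δ G} → OK s ((φ₁ ∨′ φ₂ ∷ Γ ⊢ Δ) ∷ G) →
        Deriv s P ((φ₁ ∷ Γ ⊢ Δ) ∷ G) →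
        Deriv s P ((φ₂ ∷ Γ ⊢ Δ) ∷ G) →
        Deriv s P ((φ₁ ∨′ φ₂ ∷ Γ ⊢ Δ) ∷ G)
  ∨R₁ : ∀ {φ₁ φ₂ Γ Δ G} → OK s ((Γ ⊢ Δ ++ [ φ₁ ∨′ φ₂ ]) ∷ G) →
        Deriv s P ((Γ ⊢ Δ ++ [ φ₁ ]) ∷ G) →
        Deriv s P ((Γ ⊢ Δ ++ [ φ₁ ∨′ φ₂ ]) ∷ G)
  ∨R₂ : ∀ {φ₁ φ₂ Γ Δ G} → OK s ((Γ ⊢ Δ ++ [ φ₁ ∨′ φ₂ ]) ∷ G) →
        Deriv s P ((Γ ⊢ Δ ++ [ φ₂ ]) ∷ G) →
        Deriv s P ((Γ ⊢ Δ ++ [ φ₁ ∨′ φ₂ ]) ∷ G)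
  ⇒L  : ∀ {φ ψ Γ Δ G} → OK s ((φ ⇒′ ψ ∷ Γ ⊢ Δ) ∷ G) →
        Deriv s P ((Γ ⊢ Δ ++ [ φ ]) ∷ G) →
        Deriv s P ((ψ ∷ Γ ⊢ Δ) ∷ G) →
        Deriv s P ((φ ⇒′ ψ ∷ Γ ⊢ Δ) ∷ G)
  -- HLK implication-right: part of ∀HLJ (restricted to single conclusions)
  ⇒R  : ∀ {φ ψ Γ Δ G} → s ≡ ∀HLJ → OK s ((Γ ⊢ Δ ++ [ φ ⇒′ ψ ]) ∷ G) →
        Deriv s P ((φ ∷ Γ ⊢ Δ ++ [ ψ ]) ∷ G) →
        Deriv s P ((Γ ⊢ Δ ++ [ φ ⇒′ ψ ]) ∷ G)
  -- the replacing implication-right rule of HLJ'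
  ⇒R′ : ∀ {φ ψ Γ G} → s ≡ ∀HLJ′ → OK s ((Γ ⊢ [ φ ⇒′ ψ ]) ∷ G) →
        Deriv s P ((φ ∷ Γ ⊢ [ ψ ]) ∷ G) →
        Deriv s P ((Γ ⊢ [ φ ⇒′ ψ ]) ∷ G)
  ∀L : ∀ {x φ t Γ Δ G} → FreeFor t x φ → OK s ((∀′ x φ ∷ Γ ⊢ Δ) ∷ G) →
       Deriv s P ((substF x t φ ∷ Γ ⊢ Δ) ∷ G) →
       Deriv s P ((∀′ x φ ∷ Γ ⊢ Δ) ∷ G)
  ∀R : ∀ {x φ Γ} → ¬ FreeInL x Γ → OK s ((Γ ⊢ [ ∀′ x φ ]) ∷ []) →
       Deriv s P ((Γ ⊢ [ φ ]) ∷ []) →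
       Deriv s P ((Γ ⊢ [ ∀′ x φ ]) ∷ [])
  ∃L : ∀ {x φ Γ Δ} → ¬ FreeInL x (Γ ++ Δ) → OK s ((∃′ x φ ∷ Γ ⊢ Δ) ∷ []) →
       Deriv s P ((φ ∷ Γ ⊢ Δ) ∷ []) →
       Deriv s P ((∃′ x φ ∷ Γ ⊢ Δ) ∷ [])
  ∃R : ∀ {x ψ t Γ Δ G} → FreeFor t x ψ → OK s ((Γ ⊢ Δ ++ [ ∃′ x ψ ]) ∷ G) →
       Deriv s P ((Γ ⊢ Δ ++ [ substF x t ψ ]) ∷ G) →
       Deriv s P ((Γ ⊢ Δ ++ [ ∃′ x ψ ]) ∷ G)

-- (∀-R_ms):  Γ ⇒ φ | G  /  Γ ⇒ ∀xφ | G,  x not free in the conclusion.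
-- It is a derived rule of system s if for every instance (whose premise
-- and conclusion belong to the language of s) the conclusion is
-- derivable in s from the premise.

RmsPremise : List Formula → Formula → Hypersequent → Hypersequent
RmsPremise Γ φ G = (Γ ⊢ [ φ ]) ∷ G

RmsConclusion : List Formula → ℕ → Formula → Hypersequent → Hypersequent
RmsConclusion Γ x φ G = (Γ ⊢ [ ∀′ x φ ]) ∷ G

DerivedRms : System → Set
DerivedRms s =
  ∀ (Γ : List Formula) (x : ℕ) (φ : Formula) (G : Hypersequent) →
  ¬ FreeInH x (RmsConclusion Γ x φ G) →
  OK s (RmsPremise Γ φ G) → OK s (RmsConclusion Γ x φ G) →
  Deriv s (RmsPremise Γ φ G) (RmsConclusion Γ x φ G)

-- Every rule of ∀HLJ and ∀HLJ′ preserves validity in Kripke models whose hypersequents are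
-- read componentwise: a hypersequent is true at a world if one of its components is forced
-- there.  The right ∀-rule stays sound only because it has no side components.  In the model
-- with a root world holding one object a, a top world adding a second object b, P true of a
-- only and Q true at the top world only, the hypersequent ⇒ P(x) | ⇒ Q is valid: at the root
-- x can only denote a, at the top world Q holds.  But ⇒ ∀x P(x) | ⇒ Q fails at the root,
-- because b refutes ∀x P(x) later on and Q does not hold at the root.
module Submission where

open import Defs
open import Data.Product using (_×_; _,_; Σ) renaming (map to ×-map)
open import Relation.Nullary using (¬_; yes; no)

open import Data.Nat using (ℕ; zero; suc; _≟_; z≤n; s≤s)
open import Data.Bool using (Bool; true; false; _≤_; b≤b; f≤t)
open import Data.Bool.Properties using (≤-refl; ≤-trans; ≤-minimum)
open import Data.List using (List; []; _∷_; _++_; [_]; map)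
open import Data.List.Relation.Unary.All as All using (All; []; _∷_)
open import Data.List.Relation.Unary.All.Properties using () renaming (++⁻ to All-++⁻)
open import Data.List.Relation.Unary.Any using (Any; here; there)
open import Data.List.Relation.Unary.Any.Properties
  using (++⁺ˡ; ++⁺ʳ; singleton⁻) renaming (++⁻ to Any-++⁻)
open import Data.List.Relation.Binary.Permutation.Propositional using (_↭_; ↭-refl; ↭-swap)
open import Data.List.Relation.Binary.Permutation.Propositional.Properties
  using (Any-resp-↭; All-resp-↭) renaming (++⁺ˡ to ↭-++⁺ˡ)
open import Data.Sum using (_⊎_; inj₁; inj₂; [_,_]′) renaming (map to ⊎-map; map₂ to ⊎-map₂)
open import Data.Empty using (⊥; ⊥-elim)
open import Data.Unit using (tt)
open import Function using (_∘_; id)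
open import Function.Bundles using (_⇔_; mk⇔; Equivalence)
open import Function.Properties.Equivalence using () renaming (refl to ⇔-refl; trans to ⇔-trans)
open import Relation.Binary.PropositionalEquality
  using (_≡_; _≢_; refl; sym; trans; cong; cong₂; subst)

open Equivalence using (to; from)

swap-after : ∀ {A : Set} (xs : List A) {a b zs} → xs ++ a ∷ b ∷ zs ↭ xs ++ b ∷ a ∷ zs
swap-after xs {a} {b} = ↭-++⁺ˡ xs (↭-swap a b ↭-refl)

module _ {A : Set} {P : A → Set} where

  Any-contract-head : ∀ {x xs} → Any P (x ∷ x ∷ xs) → Any P (x ∷ xs)
  Any-contract-head (here p)  = here p
  Any-contract-head (there p) = p

  Any-mapHead : ∀ {x y xs} → (P x → P y) → Any P (x ∷ xs) → Any P (y ∷ xs)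
  Any-mapHead f (here p)  = here (f p)
  Any-mapHead f (there p) = there p

  Any-zipHead : ∀ {x y z xs} → (P x → P y → P z) →
                Any P (x ∷ xs) → Any P (y ∷ xs) → Any P (z ∷ xs)
  Any-zipHead f (here p)  (here q)  = here (f p q)
  Any-zipHead f (here _)  (there q) = there q
  Any-zipHead f (there p) _         = there p

  Any-snoc⁻ : ∀ xs {x} → Any P (xs ++ [ x ]) → Any P xs ⊎ P x
  Any-snoc⁻ xs = ⊎-map₂ singleton⁻ ∘ Any-++⁻ xs

  Any-snoc-map : ∀ xs {x y} → (P x → P y) → Any P (xs ++ [ x ]) → Any P (xs ++ [ y ])
  Any-snoc-map xs f = [ ++⁺ˡ , ++⁺ʳ xs ∘ here ∘ f ]′ ∘ Any-snoc⁻ xs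

  Any-snoc-zip : ∀ xs {x y z} → (P x → P y → P z) →
                 Any P (xs ++ [ x ]) → Any P (xs ++ [ y ]) → Any P (xs ++ [ z ])
  Any-snoc-zip xs f p q with Any-snoc⁻ xs p | Any-snoc⁻ xs q
  ... | inj₁ p′ | _       = ++⁺ˡ p′
  ... | inj₂ _  | inj₁ q′ = ++⁺ˡ q′
  ... | inj₂ p′ | inj₂ q′ = ++⁺ʳ xs (here (f p′ q′))

  Any-snoc-contract : ∀ xs {x} → Any P (xs ++ x ∷ x ∷ []) → Any P (xs ++ [ x ])
  Any-snoc-contract xs p with Any-++⁻ xs p
  ... | inj₁ p′         = ++⁺ˡ p′
  ... | inj₂ (here p′)  = ++⁺ʳ xs (here p′)
  ... | inj₂ (there p′) = ++⁺ʳ xs p′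

Env : Set
Env = ℕ → Bool

update : Env → ℕ → Bool → Env
update ρ x d n with x ≟ n
... | yes _ = d
... | no  _ = ρ n

update-≡ : ∀ ρ x d → update ρ x d x ≡ d
update-≡ ρ x d with x ≟ x
... | yes _   = refl
... | no  x≢x = ⊥-elim (x≢x refl)

update-≢ : ∀ ρ {x n} d → n ≢ x → update ρ x d n ≡ ρ n
update-≢ ρ {x} {n} d n≢x with x ≟ n
... | yes x≡n = ⊥-elim (n≢x (sym x≡n))
... | no  _   = refl

update-cong : ∀ {ρ σ} y d n → (n ≢ y → ρ n ≡ σ n) → update ρ y d n ≡ update σ y d n
update-cong y d n agree with y ≟ n
... | yes _   = refl
... | no  y≢n = agree (y≢n ∘ sym)

update-comm : ∀ ρ {x y} d e → x ≢ y → ∀ n →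
              update (update ρ y d) x e n ≡ update (update ρ x e) y d n
update-comm ρ {x} {y} d e x≢y n with x ≟ n | y ≟ n
... | yes refl | yes refl = ⊥-elim (x≢y refl)
... | yes refl | no  _    = sym (update-≡ ρ x e)
... | no  _    | yes refl = update-≡ ρ y d
... | no  x≢n  | no  y≢n  = trans (update-≢ ρ d (y≢n ∘ sym)) (sym (update-≢ ρ e (x≢n ∘ sym)))

-- Function symbols all denote false, the object that exists at every world.
eval : Env → Term → Bool
eval ρ (var n)  = ρ n
eval ρ (fn _ _) = false

eval-coinc : ∀ u {ρ σ} → (∀ n → OccursT n u → ρ n ≡ σ n) → eval ρ u ≡ eval σ u
eval-coinc (var n)  agree = agree n oc-var
eval-coinc (fn _ _) agree = refl

map-eval-coinc : ∀ ts {ρ σ} → (∀ n → Any (OccursT n) ts → ρ n ≡ σ n) →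
                 map (eval ρ) ts ≡ map (eval σ) ts
map-eval-coinc []       agree = refl
map-eval-coinc (u ∷ us) agree =
  cong₂ _∷_ (eval-coinc u (λ n → agree n ∘ here)) (map-eval-coinc us (λ n → agree n ∘ there))

eval-update-notOccurs : ∀ ρ {y} d t → ¬ OccursT y t → eval (update ρ y d) t ≡ eval ρ t
eval-update-notOccurs ρ d t y∉t =
  eval-coinc t (λ n n∈t → update-≢ ρ d (λ n≡y → y∉t (subst (λ m → OccursT m t) n≡y n∈t)))

eval-substT : ∀ ρ x t u → eval ρ (substT x t u) ≡ eval (update ρ x (eval ρ t)) u
eval-substT ρ x t (var y) with x ≟ y
... | yes _ = refl
... | no  _ = refl
eval-substT ρ x t (fn _ _) = refl

map-eval-substTs : ∀ ρ x t ts →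
                   map (eval ρ) (substTs x t ts) ≡ map (eval (update ρ x (eval ρ t))) ts
map-eval-substTs ρ x t []       = refl
map-eval-substTs ρ x t (u ∷ us) = cong₂ _∷_ (eval-substT ρ x t u) (map-eval-substTs ρ x t us)

mutual
  substT-notOccurs : ∀ {x} t u → ¬ OccursT x u → substT x t u ≡ u
  substT-notOccurs {x} t (var y) x∉u with x ≟ y
  ... | yes refl = ⊥-elim (x∉u oc-var)
  ... | no  _    = refl
  substT-notOccurs t (fn f ts) x∉u = cong (fn f) (substTs-notOccurs t ts (x∉u ∘ oc-fn))

  substTs-notOccurs : ∀ {x} t ts → ¬ Any (OccursT x) ts → substTs x t ts ≡ ts
  substTs-notOccurs t []       x∉ts = refl
  substTs-notOccurs t (u ∷ us) x∉ts =
    cong₂ _∷_ (substT-notOccurs t u (x∉ts ∘ here)) (substTs-notOccurs t us (x∉ts ∘ there))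

substF-notFree : ∀ {x} t φ → ¬ FreeIn x φ → substF x t φ ≡ φ
substF-notFree t (atom p ts) x∉φ = cong (atom p) (substTs-notOccurs t ts (x∉φ ∘ fi-atom))
substF-notFree t ⊥′ x∉φ = refl
substF-notFree t (φ ∧′ ψ) x∉φ =
  cong₂ _∧′_ (substF-notFree t φ (x∉φ ∘ fi-∧l)) (substF-notFree t ψ (x∉φ ∘ fi-∧r))
substF-notFree t (φ ∨′ ψ) x∉φ =
  cong₂ _∨′_ (substF-notFree t φ (x∉φ ∘ fi-∨l)) (substF-notFree t ψ (x∉φ ∘ fi-∨r))
substF-notFree t (φ ⇒′ ψ) x∉φ =
  cong₂ _⇒′_ (substF-notFree t φ (x∉φ ∘ fi-⇒l)) (substF-notFree t ψ (x∉φ ∘ fi-⇒r))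
substF-notFree {x} t (∀′ y φ) x∉φ with x ≟ y
... | yes _   = refl
... | no  x≢y = cong (∀′ y) (substF-notFree t φ (x∉φ ∘ fi-∀ x≢y))
substF-notFree {x} t (∃′ y φ) x∉φ with x ≟ y
... | yes _   = refl
... | no  x≢y = cong (∃′ y) (substF-notFree t φ (x∉φ ∘ fi-∃ x≢y))

-- Kripke models on the two worlds false ≤ true, where the objects existing at w are the
-- d ≤ w; only the interpretation I of the predicate symbols varies.
module TwoWorldModel
  (I : ℕ → Bool → List Bool → Set)
  (I-mono : ∀ {p w v ds} → w ≤ v → I p w ds → I p v ds)
  where

  Sat : Bool → Env → Formula → Set
  Sat w ρ (atom p ts) = I p w (map (eval ρ) ts)
  Sat w ρ ⊥′          = ⊥
  Sat w ρ (φ ∧′ ψ)    = Sat w ρ φ × Sat w ρ ψ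
  Sat w ρ (φ ∨′ ψ)    = Sat w ρ φ ⊎ Sat w ρ ψ
  Sat w ρ (φ ⇒′ ψ)    = ∀ v → w ≤ v → Sat v ρ φ → Sat v ρ ψ
  Sat w ρ (∀′ y φ)    = ∀ v → w ≤ v → ∀ d → d ≤ v → Sat v (update ρ y d) φ
  Sat w ρ (∃′ y φ)    = Σ Bool λ d → d ≤ w × Sat w (update ρ y d) φ

  Sat-mono : ∀ φ {w v ρ} → w ≤ v → Sat w ρ φ → Sat v ρ φ
  Sat-mono (atom p ts) w≤v s            = I-mono w≤v s
  Sat-mono ⊥′          _   ()
  Sat-mono (φ ∧′ ψ)    w≤v (a , b)      = Sat-mono φ w≤v a , Sat-mono ψ w≤v b
  Sat-mono (φ ∨′ ψ)    w≤v (inj₁ a)     = inj₁ (Sat-mono φ w≤v a)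
  Sat-mono (φ ∨′ ψ)    w≤v (inj₂ b)     = inj₂ (Sat-mono ψ w≤v b)
  Sat-mono (φ ⇒′ ψ)    w≤v f            = λ u v≤u → f u (≤-trans w≤v v≤u)
  Sat-mono (∀′ y φ)    w≤v f            = λ u v≤u → f u (≤-trans w≤v v≤u)
  Sat-mono (∃′ y φ)    w≤v (d , d≤w , s) = d , ≤-trans d≤w w≤v , Sat-mono φ w≤v s

  All-Sat-mono : ∀ {Γ w v ρ} → w ≤ v → All (Sat w ρ) Γ → All (Sat v ρ) Γ
  All-Sat-mono w≤v = All.map (λ {φ} → Sat-mono φ w≤v)

  Sat-coinc : ∀ φ {w ρ σ} → (∀ n → FreeIn n φ → ρ n ≡ σ n) → Sat w ρ φ → Sat w σ φ
  Sat-coinc (atom p ts) {w} agree = subst (I p w) (map-eval-coinc ts (λ n → agree n ∘ fi-atom))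
  Sat-coinc ⊥′ _ ()
  Sat-coinc (φ ∧′ ψ) agree (a , b) =
    Sat-coinc φ (λ n → agree n ∘ fi-∧l) a , Sat-coinc ψ (λ n → agree n ∘ fi-∧r) b
  Sat-coinc (φ ∨′ ψ) agree (inj₁ a) = inj₁ (Sat-coinc φ (λ n → agree n ∘ fi-∨l) a)
  Sat-coinc (φ ∨′ ψ) agree (inj₂ b) = inj₂ (Sat-coinc ψ (λ n → agree n ∘ fi-∨r) b)
  Sat-coinc (φ ⇒′ ψ) agree f = λ v w≤v a →
    Sat-coinc ψ (λ n → agree n ∘ fi-⇒r) (f v w≤v (Sat-coinc φ (λ n → sym ∘ agree n ∘ fi-⇒l) a))
  Sat-coinc (∀′ y φ) agree f = λ v w≤v d d≤v →
    Sat-coinc φ (λ n n∈φ → update-cong y d n (λ n≢y → agree n (fi-∀ n≢y n∈φ))) (f v w≤v d d≤v)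
  Sat-coinc (∃′ y φ) agree (d , d≤w , s) =
    d , d≤w , Sat-coinc φ (λ n n∈φ → update-cong y d n (λ n≢y → agree n (fi-∃ n≢y n∈φ))) s

  Sat-ext : ∀ φ {w ρ σ} → (∀ n → ρ n ≡ σ n) → Sat w ρ φ ⇔ Sat w σ φ
  Sat-ext φ ρ≗σ = mk⇔ (Sat-coinc φ (λ n _ → ρ≗σ n)) (Sat-coinc φ (λ n _ → sym (ρ≗σ n)))

  Sat-update-notFree : ∀ φ {w ρ x} d → ¬ FreeIn x φ → Sat w ρ φ ⇔ Sat w (update ρ x d) φ
  Sat-update-notFree φ {ρ = ρ} {x} d x∉φ =
    mk⇔ (Sat-coinc φ (λ n n∈φ → sym (update-≢ ρ d (n≢x n∈φ))))
        (Sat-coinc φ (λ n n∈φ → update-≢ ρ d (n≢x n∈φ)))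
    where
      n≢x : ∀ {n} → FreeIn n φ → n ≢ x
      n≢x n∈φ n≡x = x∉φ (subst (λ m → FreeIn m φ) n≡x n∈φ)

  Sat-substF-notFree : ∀ φ {w ρ x} t → ¬ FreeIn x φ →
                       Sat w ρ (substF x t φ) ⇔ Sat w (update ρ x (eval ρ t)) φ
  Sat-substF-notFree φ {ρ = ρ} t x∉φ rewrite substF-notFree t φ x∉φ =
    Sat-update-notFree φ (eval ρ t) x∉φ

  Sat-substF-underBinder :
    ∀ φ {t x y} → x ≢ y → ¬ OccursT y t →
    (∀ w ρ → Sat w ρ (substF x t φ) ⇔ Sat w (update ρ x (eval ρ t)) φ) →
    ∀ w ρ d → Sat w (update ρ y d) (substF x t φ) ⇔ Sat w (update (update ρ x (eval ρ t)) y d) φ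
  Sat-substF-underBinder φ {t} {x} {y} x≢y y∉t substφ w ρ d =
    ⇔-trans (substφ w (update ρ y d)) (Sat-ext φ swap-updates)
    where
      swap-updates : ∀ n → update (update ρ y d) x (eval (update ρ y d) t) n
                         ≡ update (update ρ x (eval ρ t)) y d n
      swap-updates n rewrite eval-update-notOccurs ρ d t y∉t = update-comm ρ d (eval ρ t) x≢y n

  Sat-substF : ∀ φ {t x} → FreeFor t x φ → ∀ w ρ →
               Sat w ρ (substF x t φ) ⇔ Sat w (update ρ x (eval ρ t)) φ
  Sat-substF (atom p ts) {t} {x} _ w ρ rewrite map-eval-substTs ρ x t ts = ⇔-refl
  Sat-substF ⊥′ _ w ρ = ⇔-refl
  Sat-substF (φ ∧′ ψ) (ff-∧ ffφ ffψ) w ρ =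
    mk⇔ (×-map (to (Sat-substF φ ffφ w ρ)) (to (Sat-substF ψ ffψ w ρ)))
        (×-map (from (Sat-substF φ ffφ w ρ)) (from (Sat-substF ψ ffψ w ρ)))
  Sat-substF (φ ∨′ ψ) (ff-∨ ffφ ffψ) w ρ =
    mk⇔ (⊎-map (to (Sat-substF φ ffφ w ρ)) (to (Sat-substF ψ ffψ w ρ)))
        (⊎-map (from (Sat-substF φ ffφ w ρ)) (from (Sat-substF ψ ffψ w ρ)))
  Sat-substF (φ ⇒′ ψ) (ff-⇒ ffφ ffψ) w ρ =
    mk⇔ (λ f v w≤v a → to (Sat-substF ψ ffψ v ρ) (f v w≤v (from (Sat-substF φ ffφ v ρ) a)))
        (λ f v w≤v a → from (Sat-substF ψ ffψ v ρ) (f v w≤v (to (Sat-substF φ ffφ v ρ) a)))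
  Sat-substF (∀′ y φ) {t} (ff-∀-nf x∉φ) w ρ = Sat-substF-notFree (∀′ y φ) t x∉φ
  Sat-substF (∀′ y φ) {t} {x} (ff-∀ y∉t ff) w ρ with x ≟ y
  ... | yes refl = Sat-update-notFree (∀′ y φ) (eval ρ t) λ { (fi-∀ y≢y _) → y≢y refl }
  ... | no  x≢y  =
    mk⇔ (λ f v w≤v d d≤v → to (body v d) (f v w≤v d d≤v))
        (λ f v w≤v d d≤v → from (body v d) (f v w≤v d d≤v))
    where
      body : ∀ v d → Sat v (update ρ y d) (substF x t φ) ⇔ Sat v (update (update ρ x (eval ρ t)) y d) φ
      body v = Sat-substF-underBinder φ x≢y y∉t (Sat-substF φ ff) v ρ
  Sat-substF (∃′ y φ) {t} (ff-∃-nf x∉φ) w ρ = Sat-substF-notFree (∃′ y φ) t x∉φ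
  Sat-substF (∃′ y φ) {t} {x} (ff-∃ y∉t ff) w ρ with x ≟ y
  ... | yes refl = Sat-update-notFree (∃′ y φ) (eval ρ t) λ { (fi-∃ y≢y _) → y≢y refl }
  ... | no  x≢y  =
    mk⇔ (λ { (d , d≤w , s) → d , d≤w , to (body d) s })
        (λ { (d , d≤w , s) → d , d≤w , from (body d) s })
    where
      body : ∀ d → Sat w (update ρ y d) (substF x t φ) ⇔ Sat w (update (update ρ x (eval ρ t)) y d) φ
      body = Sat-substF-underBinder φ x≢y y∉t (Sat-substF φ ff) w ρ

  All-Sat-update-notFree : ∀ {Γ w ρ x} d → ¬ Any (FreeIn x) Γ →
                           All (Sat w ρ) Γ → All (Sat w (update ρ x d)) Γ
  All-Sat-update-notFree d x∉Γ [] = []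
  All-Sat-update-notFree {φ ∷ _} d x∉Γ (a ∷ as) =
    to (Sat-update-notFree φ d (x∉Γ ∘ here)) a ∷ All-Sat-update-notFree d (x∉Γ ∘ there) as

  Any-Sat-update-notFree : ∀ {Δ w ρ x} d → ¬ Any (FreeIn x) Δ →
                           Any (Sat w (update ρ x d)) Δ → Any (Sat w ρ) Δ
  Any-Sat-update-notFree {φ ∷ _} d x∉Δ (here a) = here (from (Sat-update-notFree φ d (x∉Δ ∘ here)) a)
  Any-Sat-update-notFree {_ ∷ _} d x∉Δ (there a) = there (Any-Sat-update-notFree d (x∉Δ ∘ there) a)

  record InDomain (w : Bool) (ρ : Env) : Set where
    constructor inDomain
    field bounded : ∀ n → ρ n ≤ w

  eval-inDomain : ∀ t {w ρ} → InDomain w ρ → eval ρ t ≤ w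
  eval-inDomain (var n)  (inDomain ρ≤w) = ρ≤w n
  eval-inDomain (fn _ _) {w} _          = ≤-minimum w

  inDomain-update : ∀ x {d w v ρ} → InDomain w ρ → w ≤ v → d ≤ v → InDomain v (update ρ x d)
  inDomain-update x {d} {w} {v} {ρ} (inDomain ρ≤w) w≤v d≤v = inDomain bounded
    where
      bounded : ∀ n → update ρ x d n ≤ v
      bounded n with x ≟ n
      ... | yes _ = d≤v
      ... | no  _ = ≤-trans (ρ≤w n) w≤v

  Forced : Bool → Env → Sequent → Set
  Forced w ρ (Γ ⊢ Δ) = ∀ v → w ≤ v → All (Sat v ρ) Γ → Any (Sat v ρ) Δ

  TrueAt : Bool → Env → Hypersequent → Set
  TrueAt w ρ H = Any (Forced w ρ) H

  Valid : Hypersequent → Set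
  Valid H = ∀ {w ρ} → InDomain w ρ → TrueAt w ρ H

  forced-cut : ∀ {w ρ} Γ₀ Δ₀ {Γ₁ Δ₁ δ} → Forced w ρ (Γ₀ ⊢ Δ₀ ++ [ δ ]) →
               Forced w ρ (δ ∷ Γ₁ ⊢ Δ₁) → Forced w ρ (Γ₀ ++ Γ₁ ⊢ Δ₀ ++ Δ₁)
  forced-cut Γ₀ Δ₀ f g v w≤v γ with All-++⁻ Γ₀ γ
  ... | γ₀ , γ₁ = [ ++⁺ˡ , (λ δ → ++⁺ʳ Δ₀ (g v w≤v (δ ∷ γ₁))) ]′ (Any-snoc⁻ Δ₀ (f v w≤v γ₀))

  forced-⇒L : ∀ {w ρ φ ψ Γ} Δ → Forced w ρ (Γ ⊢ Δ ++ [ φ ]) → Forced w ρ (ψ ∷ Γ ⊢ Δ) →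
              Forced w ρ (φ ⇒′ ψ ∷ Γ ⊢ Δ)
  forced-⇒L Δ f g v w≤v (φ⇒ψ ∷ γ) =
    [ id , (λ a → g v w≤v (φ⇒ψ v ≤-refl a ∷ γ)) ]′ (Any-snoc⁻ Δ (f v w≤v γ))

  forced-⇒R : ∀ {w ρ φ ψ Γ} → Forced w ρ (φ ∷ Γ ⊢ [ ψ ]) → Forced w ρ (Γ ⊢ [ φ ⇒′ ψ ])
  forced-⇒R f v w≤v γ =
    here λ u v≤u a → singleton⁻ (f u (≤-trans w≤v v≤u) (a ∷ All-Sat-mono v≤u γ))

  forced-∀L : ∀ {w ρ x φ t Γ Δ} → FreeFor t x φ → eval ρ t ≤ w →
              Forced w ρ (substF x t φ ∷ Γ ⊢ Δ) → Forced w ρ (∀′ x φ ∷ Γ ⊢ Δ)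
  forced-∀L {ρ = ρ} {φ = φ} {t} ff t≤w f v w≤v (∀φ ∷ γ) =
    f v w≤v (from (Sat-substF φ ff v ρ) (∀φ v ≤-refl (eval ρ t) (≤-trans t≤w w≤v)) ∷ γ)

  forced-∃R : ∀ {w ρ x ψ t Γ} Δ → FreeFor t x ψ → eval ρ t ≤ w →
              Forced w ρ (Γ ⊢ Δ ++ [ substF x t ψ ]) → Forced w ρ (Γ ⊢ Δ ++ [ ∃′ x ψ ])
  forced-∃R {ρ = ρ} {ψ = ψ} {t} Δ ff t≤w f v w≤v γ =
    Any-snoc-map Δ (λ s → eval ρ t , ≤-trans t≤w w≤v , to (Sat-substF ψ ff v ρ) s) (f v w≤v γ)

  forced-∀R : ∀ {w ρ x φ Γ} → ¬ Any (FreeIn x) Γ →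
              (∀ v d → w ≤ v → d ≤ v → Forced v (update ρ x d) (Γ ⊢ [ φ ])) →
              Forced w ρ (Γ ⊢ [ ∀′ x φ ])
  forced-∀R x∉Γ f v w≤v γ = here λ u v≤u d d≤u →
    singleton⁻ (f u d (≤-trans w≤v v≤u) d≤u u ≤-refl
                  (All-Sat-update-notFree d x∉Γ (All-Sat-mono v≤u γ)))

  forced-∃L : ∀ {w ρ x φ} Γ {Δ} → ¬ Any (FreeIn x) (Γ ++ Δ) →
              (∀ v d → w ≤ v → d ≤ v → Forced v (update ρ x d) (φ ∷ Γ ⊢ Δ)) →
              Forced w ρ (∃′ x φ ∷ Γ ⊢ Δ)
  forced-∃L Γ x∉ΓΔ f v w≤v ((d , d≤v , a) ∷ γ) =
    Any-Sat-update-notFree d (x∉ΓΔ ∘ ++⁺ʳ Γ)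
      (f v d w≤v d≤v v ≤-refl (a ∷ All-Sat-update-notFree d (x∉ΓΔ ∘ ++⁺ˡ) γ))

  sound : ∀ {s P H} → Deriv s P H → Valid P → Valid H
  sound (hyp _) ⊨P = ⊨P
  sound (ax _)  _ _ = here λ { _ _ (a ∷ []) → here a }
  sound (ax⊥ _) _ _ = here λ { _ _ (() ∷ []) }
  sound (ew _ d) ⊨P dom = there (sound d ⊨P dom)
  sound (ec _ d) ⊨P dom = Any-contract-head (sound d ⊨P dom)
  sound (ee {G = G} _ d) ⊨P dom = Any-resp-↭ (swap-after G) (sound d ⊨P dom)
  sound (iwL _ d) ⊨P dom = Any-mapHead (λ { f v w≤v (_ ∷ γ) → f v w≤v γ }) (sound d ⊨P dom)
  sound (iwR _ d) ⊨P dom = Any-mapHead (λ f v w≤v → ++⁺ˡ ∘ f v w≤v) (sound d ⊨P dom)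
  sound (icL _ d) ⊨P dom = Any-mapHead (λ { f v w≤v (a ∷ γ) → f v w≤v (a ∷ a ∷ γ) }) (sound d ⊨P dom)
  sound (icR {Δ = Δ} _ d) ⊨P dom =
    Any-mapHead (λ f v w≤v → Any-snoc-contract Δ ∘ f v w≤v) (sound d ⊨P dom)
  sound (ieL {Γ = Γ} _ d) ⊨P dom =
    Any-mapHead (λ f v w≤v → f v w≤v ∘ All-resp-↭ (swap-after Γ)) (sound d ⊨P dom)
  sound (ieR {Δ = Δ} _ d) ⊨P dom =
    Any-mapHead (λ f v w≤v → Any-resp-↭ (swap-after Δ) ∘ f v w≤v) (sound d ⊨P dom)
  sound (cut {Γ₀ = Γ₀} {Δ₀} _ d e) ⊨P dom =
    Any-zipHead (forced-cut Γ₀ Δ₀) (sound d ⊨P dom) (sound e ⊨P dom)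
  sound (∧L₁ _ d) ⊨P dom = Any-mapHead (λ { f v w≤v ((a , _) ∷ γ) → f v w≤v (a ∷ γ) }) (sound d ⊨P dom)
  sound (∧L₂ _ d) ⊨P dom = Any-mapHead (λ { f v w≤v ((_ , b) ∷ γ) → f v w≤v (b ∷ γ) }) (sound d ⊨P dom)
  sound (∧R {Δ = Δ} _ d e) ⊨P dom =
    Any-zipHead (λ f g v w≤v γ → Any-snoc-zip Δ _,_ (f v w≤v γ) (g v w≤v γ))
                (sound d ⊨P dom) (sound e ⊨P dom)
  sound (∨L _ d e) ⊨P dom =
    Any-zipHead (λ { f g v w≤v (inj₁ a ∷ γ) → f v w≤v (a ∷ γ)
                   ; f g v w≤v (inj₂ b ∷ γ) → g v w≤v (b ∷ γ) })
                (sound d ⊨P dom) (sound e ⊨P dom)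
  sound (∨R₁ {Δ = Δ} _ d) ⊨P dom = Any-mapHead (λ f v w≤v → Any-snoc-map Δ inj₁ ∘ f v w≤v) (sound d ⊨P dom)
  sound (∨R₂ {Δ = Δ} _ d) ⊨P dom = Any-mapHead (λ f v w≤v → Any-snoc-map Δ inj₂ ∘ f v w≤v) (sound d ⊨P dom)
  sound (⇒L {Δ = Δ} _ d e) ⊨P dom = Any-zipHead (forced-⇒L Δ) (sound d ⊨P dom) (sound e ⊨P dom)
  sound (⇒R {Δ = []} refl _ d) ⊨P dom = Any-mapHead forced-⇒R (sound d ⊨P dom)
  sound (⇒R {Δ = _ ∷ []} refl (s≤s () ∷ _) _)
  sound (⇒R {Δ = _ ∷ _ ∷ _} refl (s≤s () ∷ _) _)
  sound (⇒R′ refl _ d) ⊨P dom = Any-mapHead forced-⇒R (sound d ⊨P dom)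
  sound (∀L {t = t} ff _ d) ⊨P dom = Any-mapHead (forced-∀L ff (eval-inDomain t dom)) (sound d ⊨P dom)
  sound (∃R {t = t} {Δ = Δ} ff _ d) ⊨P dom =
    Any-mapHead (forced-∃R Δ ff (eval-inDomain t dom)) (sound d ⊨P dom)
  sound (∀R {x = x} x∉Γ _ d) ⊨P dom = here (forced-∀R x∉Γ λ v e w≤v e≤v →
    singleton⁻ (sound d ⊨P (inDomain-update x dom w≤v e≤v)))
  sound (∃L {x = x} {Γ = Γ} x∉ΓΔ _ d) ⊨P dom = here (forced-∃L Γ x∉ΓΔ λ v e w≤v e≤v →
    singleton⁻ (sound d ⊨P (inDomain-update x dom w≤v e≤v)))

I₀ : ℕ → Bool → List Bool → Set
I₀ zero    _ ds = All (_≡ false) ds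
I₀ (suc _) w _  = w ≡ true

I₀-mono : ∀ {p w v ds} → w ≤ v → I₀ p w ds → I₀ p v ds
I₀-mono {zero}  _   i = i
I₀-mono {suc _} b≤b i = i

open TwoWorldModel I₀ I₀-mono

Px Q : Formula
Px = atom 0 [ var 0 ]
Q  = atom 1 []

side : Hypersequent
side = ([] ⊢ [ Q ]) ∷ []

premise-valid : Valid (RmsPremise [] Px side)
premise-valid {false} (inDomain ρ≤w) = here λ _ _ _ → here (bottom (ρ≤w 0) ∷ [])
  where
    bottom : ∀ {b} → b ≤ false → b ≡ false
    bottom b≤b = refl
premise-valid {true} _ = there (here λ { _ b≤b _ → here refl })

conclusion-fails : ¬ TrueAt false (λ _ → false) (RmsConclusion [] 0 Px side)
conclusion-fails (here ⊩∀Px) with ⊩∀Px true f≤t []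
... | here ∀Px with ∀Px true b≤b true b≤b
...   | () ∷ []
conclusion-fails (there (here ⊩Q)) with ⊩Q false b≤b []
... | here ()

x-notFree : ¬ FreeInH 0 (RmsConclusion [] 0 Px side)
x-notFree (here (here (fi-∀ 0≢0 _))) = 0≢0 refl
x-notFree (there (here (here (fi-atom ()))))

Rms-notDerived : ∀ s → OK s (RmsPremise [] Px side) → OK s (RmsConclusion [] 0 Px side) →
                 ¬ DerivedRms s
Rms-notDerived s ok-premise ok-conclusion rms =
  conclusion-fails (sound (rms [] 0 Px side x-notFree ok-premise ok-conclusion) premise-valid
                          (inDomain λ _ → b≤b))

mainTheorem8 : ¬ DerivedRms ∀HLJ × ¬ DerivedRms ∀HLJ′
mainTheorem8 =
  Rms-notDerived ∀HLJ (s≤s z≤n ∷ s≤s z≤n ∷ []) (s≤s z≤n ∷ s≤s z≤n ∷ []) ,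
  Rms-notDerived ∀HLJ′ tt tt
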